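{- Let $P$ be any pattern string over an alphabet $\Sigma$ of size $\Delta$, and let $T$ be a query string of length $m$ whose characters are drawn independently and uniformly at random from $\Sigma$. During the search phase of Algorithm $A$ (described in the context), the expected length by which the search window is shifted after a Type-1, Type-2 or Type-3 event is $\Omega(\min(|sparse(P)|,\Delta))$.
   Context: For an ordered pair of characters $u,v\in\Sigma$ (not necessarily distinct), $sparse^{(u,v)}(P)$ is the rightmost occurrence in $P$ of a substring of $P$ of longest length that starts with $u$, ends with $v$, and contains no occurrence of $u$ or $v$ strictly inside it. $sparse(P)$ is the longest among these; $|sparse(P)|$ its length; $startc(P)$, $endc(P)$ its first and last characters; $startpos(P)$, $endpos(P)$ their indices in $P$. With $n=|P|$, for $c\in\Sigma$: if $c$ occurs in $sparse(P)$, $shift^{c}(P)$ is the distance between the rightmost occurrence of $c$ in $sparse(P)$ and the last character of $sparse(P)$; if $c$ does not occur in $P$, $shift^{c}(P)=n$; if $c$ occurs in $P$ but not in $sparse(P)$, $shift^{c}(P)=|sparse(P)|+1$. Search phase of Algorithm $A$: set $i=0$, $j=n$ (window $T[i+1..j]$), $\hat i=startpos(P)$, $\hat j=endpos(P)$. While the window is contained in $T$: let $c=T[i+\hat j]$, $d=T[i+\hat i]$. (Type-1 event) If $c\ne endc(P)$, increase $i,j$ by $shift^{c}(P)$. (Type-2 event) Else if $d\ne startc(P)$, increase $i,j$ by $|sparse(P)|$ if $startc(P)=endc(P)$, else by $|sparse(P)|+1$. (Type-3 event) Else run the Apostolico–Giancarlo algorithm to test whether $P$ occurs at window $T[i+1..j]$,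 report it if so, then increase $i,j$ by $|sparse(P)|$ if $startc(P)=endc(P)$, else by $|sparse(P)|+1$. -}

module Defs where

open import Data.Nat using (ℕ; zero; suc; _+_; _*_; _∸_; _≤_; _<_; _≤?_; _<ᵇ_)
open import Data.Fin using (Fin)
open import Data.Fin.Properties using (_≟_)
open import Data.List using (List; []; _∷_; length; take; drop; reverse; map; concatMap; allFin)
open import Data.Nat.ListAction using (sum)
open import Data.Maybe using (Maybe; just; nothing)
open import Data.Product using (_×_; _,_; proj₂)
open import Data.Bool using (if_then_else_)
open import Relation.Nullary using (¬_; yes; no)
open import Relation.Binary.PropositionalEquality using (_≡_)

-- Strings over the alphabet Σ = Fin Δ are lists; positions are 0-based naturals.

at : ∀ {A : Set} → List A → ℕ → Maybe A
at []       _       = nothing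
at (x ∷ _)  zero    = just x
at (_ ∷ xs) (suc k) = at xs k

Valid : ∀ {Δ} → List (Fin Δ) → ℕ → ℕ → Set
Valid P s e =
  s ≤ e × e < length P ×
  (∀ k → s < k → k < e → ¬ (at P k ≡ at P s) × ¬ (at P k ≡ at P e))

-- P[s..e] is sparse(P): among all valid substrings (for all pairs (u,v)) it
-- has maximal length, and it is the rightmost valid substring of that length
-- for its own pair (u,v) = (P[s],P[e]) (i.e. it is sparse^(u,v)(P)).
IsSparse : ∀ {Δ} → List (Fin Δ) → ℕ → ℕ → Set
IsSparse P s e =
  Valid P s e ×
  (∀ s' e' → Valid P s' e' → e' ∸ s' ≤ e ∸ s) ×
  (∀ s' e' → Valid P s' e' → at P s' ≡ at P s → at P e' ≡ at P e →
     e' ∸ s' ≡ e ∸ s → s' ≤ s)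

sparseLen : ℕ → ℕ → ℕ
sparseLen s e = suc (e ∸ s)

sparseStr : ∀ {Δ} → List (Fin Δ) → ℕ → ℕ → List (Fin Δ)
sparseStr P s e = take (sparseLen s e) (drop s P)

firstIndex : ∀ {Δ} → Fin Δ → List (Fin Δ) → Maybe ℕ
firstIndex c [] = nothing
firstIndex c (x ∷ xs) with c ≟ x
... | yes _ = just zero
... | no _ with firstIndex c xs
...   | just k  = just (suc k)
...   | nothing = nothing

shiftc : ∀ {Δ} → List (Fin Δ) → ℕ → ℕ → Fin Δ → ℕ
shiftc P s e c with firstIndex c (reverse (sparseStr P s e))
... | just k  = k            -- distance from rightmost c in sparse(P) to its end
... | nothing with firstIndex c P
...   | just _  = suc (sparseLen s e)
...   | nothing = length P

eqM? : ∀ {Δ} → Maybe (Fin Δ) → Maybe (Fin Δ) → Data.Bool.Bool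
eqM? (just a) (just b) with a ≟ b
... | yes _ = Data.Bool.true
... | no _  = Data.Bool.false
eqM? nothing nothing = Data.Bool.true
eqM? _ _ = Data.Bool.false

longShift : ∀ {Δ} → List (Fin Δ) → ℕ → ℕ → ℕ
longShift P s e =
  if eqM? (at P s) (at P e) then sparseLen s e else suc (sparseLen s e)

data Event : Set where
  type1 type2 type3 : Event

-- The event at window T[i+1..i+n] (1-based), i.e. 0-based offset i, and the
-- resulting shift.  c = T[i + endpos] , d = T[i + startpos] (1-based), which
-- are the 0-based positions i+e and i+s.
step : ∀ {Δ} → List (Fin Δ) → ℕ → ℕ → List (Fin Δ) → ℕ → Event × ℕ
step P s e T i with at T (i + e)
... | nothing = type1 , 0    -- unreachable while the window lies in T
... | just c with eqM? (just c) (at P e)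
...   | Data.Bool.false = type1 , shiftc P s e c
...   | Data.Bool.true with eqM? (at T (i + s)) (at P s)
...     | Data.Bool.false = type2 , longShift P s e
...     | Data.Bool.true  = type3 , longShift P s e
-- (In a Type-3 event Apostolico–Giancarlo is run to test/report an
--  occurrence; this does not affect the shift, so it is not modelled.)

-- The sequence of events (with their shifts) of the search phase, starting
-- from offset i; the loop continues while the window T[i+1..i+n] lies in T.
-- 'fuel' only serves termination; every shift is ≥ 1, so fuel |T|+1 suffices.
runFrom : ∀ {Δ} → List (Fin Δ) → ℕ → ℕ → List (Fin Δ) → ℕ → ℕ → List (Event × ℕ)
runFrom P s e T zero i = []
runFrom P s e T (suc f) i with (i + length P) ≤? length T
... | no _  = []
... | yes _ = let ev = step P s e T i in ev ∷ runFrom P s e T f (i + proj₂ ev)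

run : ∀ {Δ} → List (Fin Δ) → ℕ → ℕ → List (Fin Δ) → List (Event × ℕ)
run P s e T = runFrom P s e T (suc (length T)) 0

-- all strings of length m over Fin Δ (each exactly once): the uniform
-- distribution on Σ^m is the counting measure on this list.
allStrings : ∀ Δ → ℕ → List (List (Fin Δ))
allStrings Δ zero    = [] ∷ []
allStrings Δ (suc m) = concatMap (λ x → map (x ∷_) (allStrings Δ m)) (allFin Δ)

-- shift of the k-th event (0-based) of a run, 0 if there is no k-th event
kthShift : List (Event × ℕ) → ℕ → ℕ
kthShift [] _ = 0
kthShift ((_ , sh) ∷ _)  zero    = sh
kthShift (_ ∷ evs) (suc k) = kthShift evs k

countHasEvent : ∀ {Δ} → List (Fin Δ) → ℕ → ℕ → ℕ → ℕ → ℕ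
countHasEvent {Δ} P s e m k =
  sum (map (λ T → if k <ᵇ length (run P s e T) then 1 else 0) (allStrings Δ m))

totalKthShift : ∀ {Δ} → List (Fin Δ) → ℕ → ℕ → ℕ → ℕ → ℕ
totalKthShift {Δ} P s e m k =
  sum (map (λ T → kthShift (run P s e T) k) (allStrings Δ m))

-- The shift made at each event is F c, where F = shiftOn and c is the text character under
-- endpos(P); no earlier event has looked at that character, because every shift is positive.
-- So for uniform texts the expected k-th shift is the mean (1/Δ) ∑_c F c.  A value of F below
-- |sparse(P)| determines c (it is the character at that distance from the end of sparse(P)),
-- hence at most t characters have F c ≤ t, which forces ∑_c F c ≥ Δ · min(|sparse(P)|, Δ) / 2.
module Submission where

open import Defs
open import Data.Nat using (ℕ; suc; _*_; _≤_; _<_; _⊓_)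
open import Data.Fin using (Fin)
open import Data.List using (List; length)
open import Data.Product using (Σ; _×_)

open import Data.Nat using (zero; _+_; _∸_; _^_; _<ᵇ_; _≤?_; z≤n; s≤s; z<s; NonZero)
open import Data.Nat.Properties hiding (_≟_; suc-injective)
open import Data.Nat.Tactic.RingSolver using (solve-∀)
open import Data.Nat.ListAction using (sum)
open import Data.Fin using (zero; suc)
open import Data.Fin.Properties using (nonZeroIndex; _≟_; suc-injective)
open import Data.List using ([]; _∷_; [_]; _++_; _∷ʳ_; take; drop; reverse; map; concatMap; allFin; tabulate)
open import Data.List.Properties using (length-drop; length-map; drop-drop; map-++; map-∘; map-tabulate; reverse-++)
open import Data.Nat.ListAction.Properties using (sum-++)
open import Data.Maybe using (just; nothing)
open import Data.Maybe.Properties using (just-injective)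
open import Data.Bool using (true; false; if_then_else_)
open import Data.Product using (∃; _,_; proj₂)
open import Data.Sum using (_⊎_; inj₁; inj₂)
open import Function using (_∘_; id; case_of_)
open import Relation.Nullary using (¬_; yes; no; contradiction)
open import Relation.Binary.PropositionalEquality using (_≡_; refl; sym; trans; cong; subst; module ≡-Reasoning)
open import Algebra.Properties.CommutativeSemigroup +-commutativeSemigroup using (xy∙z≈xz∙y)
open import Algebra.Properties.Semiring.Sum +-*-semiring
  using (sum-syntax; sum-cong-≗; ∑-distrib-+; *-distribˡ-sum; *-distribʳ-sum)

∑-const : ∀ n a → ∑[ i < n ] a ≡ n * a
∑-const zero    a = refl
∑-const (suc n) a = cong (a +_) (∑-const n a)

∑-mono-≤ : ∀ {n} {f g : Fin n → ℕ} → (∀ i → f i ≤ g i) → ∑[ i < n ] f i ≤ ∑[ i < n ] g i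
∑-mono-≤ {zero}  f≤g = z≤n
∑-mono-≤ {suc n} f≤g = +-mono-≤ (f≤g zero) (∑-mono-≤ (f≤g ∘ suc))

∑-zero : ∀ {n} {f : Fin n → ℕ} → (∀ i → f i ≡ 0) → ∑[ i < n ] f i ≡ 0
∑-zero {n} f≡0 = trans (sum-cong-≗ f≡0) (trans (∑-const n 0) (*-zeroʳ n))

∑-≤1 : ∀ {n} {f : Fin n → ℕ} → (∀ i → f i ≤ 1) → (∀ i j → f i ≡ 1 → f j ≡ 1 → i ≡ j) →
       ∑[ i < n ] f i ≤ 1
∑-≤1 {zero}      f≤1 unique = z≤n
∑-≤1 {suc n} {f} f≤1 unique with f zero in f₀ | f≤1 zero
... | zero  | _ = ∑-≤1 (f≤1 ∘ suc) (λ i j fi fj → suc-injective (unique (suc i) (suc j) fi fj))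
... | suc (suc _) | s≤s ()
... | suc zero | _ = ≤-reflexive (cong suc (∑-zero rest≡0))
  where
  rest≡0 : ∀ i → f (suc i) ≡ 0
  rest≡0 i with f (suc i) in fᵢ | f≤1 (suc i)
  ... | zero  | _ = refl
  ... | suc zero | _ with () ← unique zero (suc i) f₀ fᵢ
  ... | suc (suc _) | s≤s ()

χ< χ≥ χ≡ : ℕ → ℕ → ℕ
χ< t       zero    = 0
χ< zero    (suc x) = 1
χ< (suc t) (suc x) = χ< t x

χ≥ t       zero    = 1
χ≥ zero    (suc x) = 0
χ≥ (suc t) (suc x) = χ≥ t x

χ≡ zero    zero    = 1
χ≡ zero    (suc x) = 0
χ≡ (suc t) zero    = 0
χ≡ (suc t) (suc x) = χ≡ t x

χ<+χ≥≡1 : ∀ t x → χ< t x + χ≥ t x ≡ 1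
χ<+χ≥≡1 t       zero    = refl
χ<+χ≥≡1 zero    (suc x) = refl
χ<+χ≥≡1 (suc t) (suc x) = χ<+χ≥≡1 t x

χ≥-suc : ∀ t x → χ≥ (suc t) x ≡ χ≥ t x + χ≡ (suc t) x
χ≥-suc t       zero          = refl
χ≥-suc zero    (suc zero)    = refl
χ≥-suc zero    (suc (suc x)) = refl
χ≥-suc (suc t) (suc x)       = χ≥-suc t x

χ≡≤1 : ∀ t x → χ≡ t x ≤ 1
χ≡≤1 zero    zero    = s≤s z≤n
χ≡≤1 zero    (suc x) = z≤n
χ≡≤1 (suc t) zero    = z≤n
χ≡≤1 (suc t) (suc x) = χ≡≤1 t x

χ≡≡1⇒≡ : ∀ t x → χ≡ t x ≡ 1 → x ≡ t
χ≡≡1⇒≡ zero    zero    _  = refl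
χ≡≡1⇒≡ (suc t) (suc x) eq = cong suc (χ≡≡1⇒≡ t x eq)

⊓-suc : ∀ x t → x ⊓ suc t ≡ x ⊓ t + χ< t x
⊓-suc zero    t       = refl
⊓-suc (suc x) zero    = cong suc (⊓-zeroʳ x)
⊓-suc (suc x) (suc t) = cong suc (⊓-suc x t)

InjectiveBelow : ∀ {n} → ℕ → (Fin n → ℕ) → Set
InjectiveBelow L F = ∀ c c′ → F c ≡ F c′ → F c < L → c ≡ c′

-- If F is positive and injective on the values below L, then at most t of its values are ≤ t
-- (for t < L), so ∑ (F c ⊓ t) grows by at least Δ ∸ t when t increases; summing up to
-- M = L ⊓ Δ gives ∑ F ≥ M Δ − M (M − 1)/2 ≥ M Δ / 2.
module _ {Δ L : ℕ} (F : Fin Δ → ℕ) (F-pos : ∀ c → 0 < F c) (F-inj : InjectiveBelow L F) where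

  private
    countAbove countAtMost truncatedSum : ℕ → ℕ
    countAbove   t = ∑[ c < Δ ] χ< t (F c)
    countAtMost  t = ∑[ c < Δ ] χ≥ t (F c)
    truncatedSum t = ∑[ c < Δ ] (F c ⊓ t)

    countAbove+countAtMost : ∀ t → countAbove t + countAtMost t ≡ Δ
    countAbove+countAtMost t = begin
      countAbove t + countAtMost t          ≡⟨ ∑-distrib-+ (χ< t ∘ F) (χ≥ t ∘ F) ⟨
      ∑[ c < Δ ] (χ< t (F c) + χ≥ t (F c))  ≡⟨ sum-cong-≗ (λ c → χ<+χ≥≡1 t (F c)) ⟩
      ∑[ c < Δ ] 1                          ≡⟨ ∑-const Δ 1 ⟩
      Δ * 1                                 ≡⟨ *-identityʳ Δ ⟩
      Δ                                     ∎
      where open ≡-Reasoning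

    countAtMost≤ : ∀ t → t < L → countAtMost t ≤ t
    countAtMost≤ zero    _   = ≤-reflexive (∑-zero (λ c → χ≥0 (F c) (F-pos c)))
      where χ≥0 : ∀ x → 0 < x → χ≥ 0 x ≡ 0
            χ≥0 (suc x) _ = refl
    countAtMost≤ (suc t) t<L = begin
      countAtMost (suc t)                                ≡⟨ sum-cong-≗ (λ c → χ≥-suc t (F c)) ⟩
      ∑[ c < Δ ] (χ≥ t (F c) + χ≡ (suc t) (F c))         ≡⟨ ∑-distrib-+ (χ≥ t ∘ F) (χ≡ (suc t) ∘ F) ⟩
      countAtMost t + ∑[ c < Δ ] χ≡ (suc t) (F c)        ≤⟨ +-mono-≤ (countAtMost≤ t (<-trans (n<1+n t) t<L))
                                                                     (∑-≤1 (λ c → χ≡≤1 (suc t) (F c)) hitsOnce) ⟩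
      t + 1                                              ≡⟨ +-comm t 1 ⟩
      suc t                                              ∎
      where
      open ≤-Reasoning
      hitsOnce : ∀ c c′ → χ≡ (suc t) (F c) ≡ 1 → χ≡ (suc t) (F c′) ≡ 1 → c ≡ c′
      hitsOnce c c′ hc hc′ = F-inj c c′ (trans Fc≡ (sym (χ≡≡1⇒≡ (suc t) (F c′) hc′))) (subst (_< L) (sym Fc≡) t<L)
        where Fc≡ = χ≡≡1⇒≡ (suc t) (F c) hc

    truncatedSum-suc : ∀ t → truncatedSum (suc t) ≡ truncatedSum t + countAbove t
    truncatedSum-suc t = trans (sum-cong-≗ (λ c → ⊓-suc (F c) t)) (∑-distrib-+ (λ c → F c ⊓ t) (χ< t ∘ F))

    truncatedSum-bound : ∀ t → t ≤ L → 2 * (t * Δ) + t ≤ 2 * truncatedSum t + t * t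
    truncatedSum-bound zero    _   = z≤n
    truncatedSum-bound (suc t) t<L = begin
      2 * (suc t * Δ) + suc t                          ≡⟨ expand t Δ ⟩
      (2 * (t * Δ) + t) + (2 * Δ + 1)                  ≤⟨ +-mono-≤ (truncatedSum-bound t (<⇒≤ t<L)) (+-monoˡ-≤ 1 (*-monoʳ-≤ 2 Δ≤)) ⟩
      (2 * truncatedSum t + t * t) + (2 * (countAbove t + t) + 1)
                                                       ≡⟨ collect (truncatedSum t) (countAbove t) t ⟩
      2 * (truncatedSum t + countAbove t) + suc t * suc t
                                                       ≡⟨ cong (λ z → 2 * z + suc t * suc t) (truncatedSum-suc t) ⟨
      2 * truncatedSum (suc t) + suc t * suc t         ∎
      where
      open ≤-Reasoning
      expand : ∀ t Δ → 2 * (suc t * Δ) + suc t ≡ (2 * (t * Δ) + t) + (2 * Δ + 1)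
      expand = solve-∀
      collect : ∀ S a t → (2 * S + t * t) + (2 * (a + t) + 1) ≡ 2 * (S + a) + suc t * suc t
      collect = solve-∀
      Δ≤ : Δ ≤ countAbove t + t
      Δ≤ = begin
        Δ                            ≡⟨ countAbove+countAtMost t ⟨
        countAbove t + countAtMost t ≤⟨ +-monoʳ-≤ (countAbove t) (countAtMost≤ t t<L) ⟩
        countAbove t + t             ∎

  Δ*[L⊓Δ]≤2*∑ : Δ * (L ⊓ Δ) ≤ 2 * ∑[ c < Δ ] F c
  Δ*[L⊓Δ]≤2*∑ = begin
    Δ * M                 ≡⟨ *-comm Δ M ⟩
    M * Δ                 ≤⟨ +-cancelˡ-≤ (M * Δ) _ _ doubled ⟩
    2 * truncatedSum M    ≤⟨ *-monoʳ-≤ 2 (∑-mono-≤ (λ c → m⊓n≤m (F c) M)) ⟩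
    2 * ∑[ c < Δ ] F c    ∎
    where
    open ≤-Reasoning
    M = L ⊓ Δ
    regroup : ∀ a b → a + (a + b) ≡ 2 * a + b
    regroup = solve-∀
    doubled : M * Δ + M * Δ ≤ M * Δ + 2 * truncatedSum M
    doubled = begin
      M * Δ + M * Δ                 ≤⟨ +-monoʳ-≤ (M * Δ) (m≤m+n (M * Δ) M) ⟩
      M * Δ + (M * Δ + M)           ≡⟨ regroup (M * Δ) M ⟩
      2 * (M * Δ) + M               ≤⟨ truncatedSum-bound M (m⊓n≤m L Δ) ⟩
      2 * truncatedSum M + M * M    ≤⟨ +-monoʳ-≤ (2 * truncatedSum M) (*-monoʳ-≤ M (m⊓n≤n L Δ)) ⟩
      2 * truncatedSum M + M * Δ    ≡⟨ +-comm (2 * truncatedSum M) (M * Δ) ⟩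
      M * Δ + 2 * truncatedSum M    ∎

∑Strings : ∀ {Δ} → ℕ → (List (Fin Δ) → ℕ) → ℕ
∑Strings     zero    h = h []
∑Strings {Δ} (suc m) h = ∑[ c < Δ ] ∑Strings m (λ U → h (c ∷ U))

sum-map-concatMap : ∀ {A B : Set} (h : B → ℕ) (g : A → List B) xs →
  sum (map h (concatMap g xs)) ≡ sum (map (λ x → sum (map h (g x))) xs)
sum-map-concatMap h g []       = refl
sum-map-concatMap h g (x ∷ xs) = begin
  sum (map h (g x ++ concatMap g xs))                          ≡⟨ cong sum (map-++ h (g x) (concatMap g xs)) ⟩
  sum (map h (g x) ++ map h (concatMap g xs))                  ≡⟨ sum-++ (map h (g x)) _ ⟩
  sum (map h (g x)) + sum (map h (concatMap g xs))             ≡⟨ cong (sum (map h (g x)) +_) (sum-map-concatMap h g xs) ⟩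
  sum (map h (g x)) + sum (map (λ x → sum (map h (g x))) xs)   ∎
  where open ≡-Reasoning

sum-tabulate : ∀ {n} (f : Fin n → ℕ) → sum (tabulate f) ≡ ∑[ i < n ] f i
sum-tabulate {zero}  f = refl
sum-tabulate {suc n} f = cong (f zero +_) (sum-tabulate (f ∘ suc))

sum-allStrings : ∀ {Δ} m (h : List (Fin Δ) → ℕ) → sum (map h (allStrings Δ m)) ≡ ∑Strings m h
sum-allStrings     zero    h = +-identityʳ (h [])
sum-allStrings {Δ} (suc m) h = begin
  sum (map h (allStrings Δ (suc m)))                            ≡⟨ sum-map-concatMap h prefixed (allFin Δ) ⟩
  sum (map (λ c → sum (map h (prefixed c))) (allFin Δ))         ≡⟨ cong sum (map-tabulate id (λ c → sum (map h (prefixed c)))) ⟩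
  sum (tabulate (λ c → sum (map h (prefixed c))))               ≡⟨ sum-tabulate (λ c → sum (map h (prefixed c))) ⟩
  ∑[ c < Δ ] sum (map h (map (c ∷_) (allStrings Δ m)))          ≡⟨ sum-cong-≗ {Δ} (λ c → cong sum (map-∘ (allStrings Δ m))) ⟨
  ∑[ c < Δ ] sum (map (λ U → h (c ∷ U)) (allStrings Δ m))       ≡⟨ sum-cong-≗ (λ c → sum-allStrings m (λ U → h (c ∷ U))) ⟩
  ∑Strings (suc m) h                                            ∎
  where
  open ≡-Reasoning
  prefixed : Fin Δ → List (List (Fin Δ))
  prefixed c = map (c ∷_) (allStrings Δ m)

∑Strings-cong : ∀ {Δ} m {g h : List (Fin Δ) → ℕ} → (∀ U → length U ≡ m → g U ≡ h U) →
                ∑Strings m g ≡ ∑Strings m h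
∑Strings-cong zero    g≡h = g≡h [] refl
∑Strings-cong (suc m) g≡h = sum-cong-≗ (λ c → ∑Strings-cong m (λ U len → g≡h (c ∷ U) (cong suc len)))

∑Strings-const : ∀ {Δ} m a → ∑Strings {Δ} m (λ _ → a) ≡ a * Δ ^ m
∑Strings-const     zero    a = sym (*-identityʳ a)
∑Strings-const {Δ} (suc m) a = begin
  ∑[ c < Δ ] ∑Strings m (λ _ → a)   ≡⟨ sum-cong-≗ {Δ} (λ _ → ∑Strings-const {Δ} m a) ⟩
  ∑[ c < Δ ] (a * Δ ^ m)            ≡⟨ ∑-const Δ (a * Δ ^ m) ⟩
  Δ * (a * Δ ^ m)                   ≡⟨ x*[y*z]≡y*[x*z] Δ a (Δ ^ m) ⟩
  a * Δ ^ suc m                     ∎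
  where
  open ≡-Reasoning
  x*[y*z]≡y*[x*z] : ∀ x y z → x * (y * z) ≡ y * (x * z)
  x*[y*z]≡y*[x*z] = solve-∀

∑Strings-*ˡ : ∀ {Δ} m a (h : List (Fin Δ) → ℕ) → ∑Strings m (λ U → a * h U) ≡ a * ∑Strings m h
∑Strings-*ˡ     zero    a h = refl
∑Strings-*ˡ {Δ} (suc m) a h = trans (sum-cong-≗ (λ c → ∑Strings-*ˡ m a (λ U → h (c ∷ U))))
                                    (sym (*-distribˡ-sum a (λ c → ∑Strings m (λ U → h (c ∷ U)))))

-- A suffix of a uniformly random string is uniformly random.
∑Strings-drop-cong : ∀ {Δ} {g h : List (Fin Δ) → ℕ} → (∀ m → ∑Strings m g ≡ ∑Strings m h) →
                     ∀ d m → ∑Strings m (g ∘ drop d) ≡ ∑Strings m (h ∘ drop d)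
∑Strings-drop-cong g≡h zero    m       = g≡h m
∑Strings-drop-cong g≡h (suc d) zero    = g≡h zero
∑Strings-drop-cong {Δ} {g} {h} g≡h (suc d) (suc m) =
  sum-cong-≗ {Δ} (λ _ → ∑Strings-drop-cong {g = g} {h} g≡h d m)

kth : List ℕ → ℕ → ℕ
kth []       _       = 0
kth (x ∷ _)  zero    = x
kth (_ ∷ xs) (suc k) = kth xs k

hasKth : ℕ → List ℕ → ℕ
hasKth k xs = if k <ᵇ length xs then 1 else 0

*kth[]≡*hasKth[] : ∀ a b k → a * kth [] k ≡ b * hasKth k []
*kth[]≡*hasKth[] a b k = trans (*-zeroʳ a) (sym (*-zeroʳ b))

∑-∑Strings-const : ∀ {Δ} m (h : Fin Δ → ℕ) →
  ∑[ c < Δ ] ∑Strings {Δ} m (λ _ → h c) ≡ (∑[ c < Δ ] h c) * Δ ^ m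
∑-∑Strings-const {Δ} m h =
  trans (sum-cong-≗ {Δ} (λ c → ∑Strings-const m (h c))) (sym (*-distribʳ-sum (Δ ^ m) h))

-- The search seen from the text suffix that starts under the last character of sparse(P):
-- read its head c, shift by F c, and stop once fewer than G characters remain.
module _ {Δ : ℕ} (F : Fin Δ → ℕ) (G : ℕ) where

  shifts : ℕ → List (Fin Δ) → List ℕ
  shifts zero    U       = []
  shifts (suc f) []      = []
  shifts (suc f) (c ∷ U) with G ≤? length (c ∷ U)
  ... | yes _ = F c ∷ shifts f (drop (F c) (c ∷ U))
  ... | no  _ = []

  shifts-stop : ∀ f U → ¬ G ≤ length U → shifts (suc f) U ≡ []
  shifts-stop f []      _ = refl
  shifts-stop f (c ∷ U) short with G ≤? length (c ∷ U)
  ... | yes fits = contradiction fits short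
  ... | no  _    = refl

  shifts-step : ∀ f c U → G ≤ length (c ∷ U) →
                shifts (suc f) (c ∷ U) ≡ F c ∷ shifts f (drop (F c) (c ∷ U))
  shifts-step f c U fits with G ≤? length (c ∷ U)
  ... | yes _     = refl
  ... | no  short = contradiction fits short

  first-shift-mean : ∀ m →
    ∑[ c < Δ ] ∑Strings m (λ _ → Δ * F c) ≡ ∑[ c < Δ ] ∑Strings m (λ _ → (∑[ c < Δ ] F c) * 1)
  first-shift-mean m = begin
    ∑[ c < Δ ] ∑Strings m (λ _ → Δ * F c)   ≡⟨ ∑-∑Strings-const {Δ} m (λ c → Δ * F c) ⟩
    (∑[ c < Δ ] (Δ * F c)) * Δ ^ m          ≡⟨ cong (_* Δ ^ m) (*-distribˡ-sum Δ F) ⟨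
    Δ * ∑F * Δ ^ m                          ≡⟨ cong (λ x → Δ * x * Δ ^ m) (*-identityʳ ∑F) ⟨
    Δ * (∑F * 1) * Δ ^ m                    ≡⟨ cong (_* Δ ^ m) (∑-const Δ (∑F * 1)) ⟨
    (∑[ c < Δ ] (∑F * 1)) * Δ ^ m           ≡⟨ ∑-∑Strings-const {Δ} m (λ _ → ∑F * 1) ⟨
    ∑[ c < Δ ] ∑Strings m (λ _ → ∑F * 1)    ∎
    where
    open ≡-Reasoning
    ∑F = ∑[ c < Δ ] F c

  shifts-mean : (∀ c → 0 < F c) → ∀ k f m →
    ∑Strings m (λ U → Δ * kth (shifts f U) k) ≡ ∑Strings m (λ U → (∑[ c < Δ ] F c) * hasKth k (shifts f U))
  shifts-mean F-pos k zero    m       = ∑Strings-cong m (λ _ _ → *kth[]≡*hasKth[] Δ (∑[ c < Δ ] F c) k)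
  shifts-mean F-pos k (suc f) zero    = *kth[]≡*hasKth[] Δ (∑[ c < Δ ] F c) k
  shifts-mean F-pos k (suc f) (suc m) with G ≤? suc m
  ... | no short = ∑Strings-cong (suc m) stopped
    where
    stopped : ∀ U → length U ≡ suc m →
              Δ * kth (shifts (suc f) U) k ≡ (∑[ c < Δ ] F c) * hasKth k (shifts (suc f) U)
    stopped U len rewrite shifts-stop f U (short ∘ subst (G ≤_) len) = *kth[]≡*hasKth[] Δ (∑[ c < Δ ] F c) k
  ... | yes fits = begin
    ∑[ c < Δ ] ∑Strings m (λ U → Δ * kth (shifts (suc f) (c ∷ U)) k)
      ≡⟨ sum-cong-≗ {Δ} (λ c → ∑Strings-cong m (λ U len → cong (λ l → Δ * kth l k) (first-step c U len))) ⟩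
    ∑[ c < Δ ] ∑Strings m (λ U → Δ * kth (F c ∷ next c U) k)
      ≡⟨ after-first-step k ⟩
    ∑[ c < Δ ] ∑Strings m (λ U → ∑F * hasKth k (F c ∷ next c U))
      ≡⟨ sum-cong-≗ {Δ} (λ c → ∑Strings-cong m (λ U len → cong (λ l → ∑F * hasKth k l) (first-step c U len))) ⟨
    ∑[ c < Δ ] ∑Strings m (λ U → ∑F * hasKth k (shifts (suc f) (c ∷ U))) ∎
    where
    open ≡-Reasoning
    ∑F = ∑[ c < Δ ] F c
    next : Fin Δ → List (Fin Δ) → List ℕ
    next c U = shifts f (drop (F c) (c ∷ U))
    first-step : ∀ c U → length U ≡ m → shifts (suc f) (c ∷ U) ≡ F c ∷ next c U
    first-step c U len = shifts-step f c U (subst (λ n → G ≤ suc n) (sym len) fits)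
    later-step : ∀ k c n → 0 < n →
      ∑Strings m (λ U → Δ * kth (n ∷ shifts f (drop n (c ∷ U))) (suc k)) ≡
      ∑Strings m (λ U → ∑F * hasKth (suc k) (n ∷ shifts f (drop n (c ∷ U))))
    later-step k c (suc d) _ = ∑Strings-drop-cong (shifts-mean F-pos k f) d m
    after-first-step : ∀ k →
      ∑[ c < Δ ] ∑Strings m (λ U → Δ * kth (F c ∷ next c U) k) ≡
      ∑[ c < Δ ] ∑Strings m (λ U → ∑F * hasKth k (F c ∷ next c U))
    after-first-step zero    = first-shift-mean m
    after-first-step (suc k) = sum-cong-≗ {Δ} (λ c → later-step k c (F c) (F-pos c))

at-drop : ∀ {A : Set} d (xs : List A) j → at (drop d xs) j ≡ at xs (d + j)
at-drop zero    xs       j = refl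
at-drop (suc d) []       j = refl
at-drop (suc d) (x ∷ xs) j = at-drop d xs j

drop≡∷⇒at : ∀ {A : Set} j (xs : List A) {c U} → drop j xs ≡ c ∷ U → at xs j ≡ just c
drop≡∷⇒at zero    (x ∷ xs) refl = refl
drop≡∷⇒at (suc j) (x ∷ xs) eq   = drop≡∷⇒at j xs eq

at-just : ∀ {A : Set} (xs : List A) {j} → j < length xs → ∃ λ y → at xs j ≡ just y
at-just (x ∷ xs) {zero}  _         = x , refl
at-just (x ∷ xs) {suc j} (s≤s j<n) = at-just xs j<n

take-suc-∷ʳ : ∀ {A : Set} (xs : List A) j {y} → at xs j ≡ just y → take (suc j) xs ≡ take j xs ∷ʳ y
take-suc-∷ʳ (x ∷ xs) zero    refl = refl
take-suc-∷ʳ (x ∷ xs) (suc j) eq   = cong (x ∷_) (take-suc-∷ʳ xs j eq)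

at-reverse-take : ∀ {A : Set} (xs : List A) j → j < length xs → at (reverse (take (suc j) xs)) 0 ≡ at xs j
at-reverse-take xs j j<n with at-just xs j<n
... | y , xs[j]≡y = begin
  at (reverse (take (suc j) xs)) 0   ≡⟨ cong (λ ys → at (reverse ys) 0) (take-suc-∷ʳ xs j xs[j]≡y) ⟩
  at (reverse (take j xs ∷ʳ y)) 0    ≡⟨ cong (λ ys → at ys 0) (reverse-++ (take j xs) [ y ]) ⟩
  just y                             ≡⟨ xs[j]≡y ⟨
  at xs j                            ∎
  where open ≡-Reasoning

firstIndex-at : ∀ {Δ} (c : Fin Δ) xs {k} → firstIndex c xs ≡ just k → at xs k ≡ just c
firstIndex-at c (x ∷ xs) eq with c ≟ x
firstIndex-at c (x ∷ xs) refl | yes refl = refl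
firstIndex-at c (x ∷ xs) eq   | no _ with firstIndex c xs in eq′
firstIndex-at c (x ∷ xs) refl | no _ | just _ = firstIndex-at c xs eq′

eqM?-false : ∀ {Δ} (c : Fin Δ) m → eqM? (just c) m ≡ false → ¬ m ≡ just c
eqM?-false c (just .c) eq refl with c ≟ c
... | yes _  = case eq of λ ()
... | no c≢c = c≢c refl

window-fits⇒ : ∀ i e n t → i + n ≤ t → n ∸ e ≤ t ∸ (i + e)
window-fits⇒ i e n t fits = subst (_≤ t ∸ (i + e)) ([m+n]∸[m+o]≡n∸o i n e) (∸-monoˡ-≤ (i + e) fits)

window-fits⇐ : ∀ i e n t → e < n → n ∸ e ≤ t ∸ (i + e) → i + n ≤ t
window-fits⇐ i e n t e<n fits = begin
  i + n                    ≡⟨ cong (i +_) (m+[n∸m]≡n (<⇒≤ e<n)) ⟨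
  i + (e + (n ∸ e))        ≡⟨ +-assoc i e (n ∸ e) ⟨
  (i + e) + (n ∸ e)        ≤⟨ +-monoʳ-≤ (i + e) fits ⟩
  (i + e) + (t ∸ (i + e))  ≡⟨ m+[n∸m]≡n (<⇒≤ i+e<t) ⟩
  t                        ∎
  where
  open ≤-Reasoning
  i+e<t : i + e < t
  i+e<t = m∸n≢0⇒n<m (m>n⇒m∸n≢0 (<-≤-trans (m<n⇒0<n∸m e<n) fits))

module _ {Δ : ℕ} (P : List (Fin Δ)) (s e : ℕ) where

  -- The shift depends only on the character c = T[i + endpos(P)]: shift^c(P) on a Type-1 event,
  -- and the long shift on Type-2 and Type-3 events, which occur exactly when c = endc(P).
  shiftOn : Fin Δ → ℕ
  shiftOn c with eqM? (just c) (at P e)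
  ... | true  = longShift P s e
  ... | false = shiftc P s e c

  step-shift : ∀ T i c → at T (i + e) ≡ just c → proj₂ (step P s e T i) ≡ shiftOn c
  step-shift T i c T[i+e]≡c rewrite T[i+e]≡c with eqM? (just c) (at P e)
  ... | false = refl
  ... | true with eqM? (at T (i + s)) (at P s)
  ...   | false = refl
  ...   | true  = refl

  sparseRev : List (Fin Δ)
  sparseRev = reverse (sparseStr P s e)

  longShift≥sparseLen : sparseLen s e ≤ longShift P s e
  longShift≥sparseLen with eqM? (at P s) (at P e)
  ... | true  = ≤-refl
  ... | false = n≤1+n (sparseLen s e)

  module _ (s≤e : s ≤ e) (e<n : e < length P) where

    sparseLen≤length : sparseLen s e ≤ length P
    sparseLen≤length = ≤-trans (s≤s (m∸n≤m e s)) e<n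

    sparseRev-head : at sparseRev 0 ≡ at P e
    sparseRev-head = begin
      at sparseRev 0              ≡⟨ at-reverse-take (drop s P) (e ∸ s) e∸s<n∸s ⟩
      at (drop s P) (e ∸ s)       ≡⟨ at-drop s P (e ∸ s) ⟩
      at P (s + (e ∸ s))          ≡⟨ cong (at P) (m+[n∸m]≡n s≤e) ⟩
      at P e                      ∎
      where
      open ≡-Reasoning
      e∸s<n∸s : e ∸ s < length (drop s P)
      e∸s<n∸s = subst (e ∸ s <_) (sym (length-drop s P)) (∸-monoˡ-< e<n s≤e)

    shiftc-cases : ∀ c → sparseLen s e ≤ shiftc P s e c ⊎ at sparseRev (shiftc P s e c) ≡ just c
    shiftc-cases c with firstIndex c sparseRev in eq
    ... | just k  = inj₂ (firstIndex-at c sparseRev eq)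
    ... | nothing with firstIndex c P
    ...   | just _  = inj₁ (n≤1+n (sparseLen s e))
    ...   | nothing = inj₁ sparseLen≤length

    shiftOn-cases : ∀ c → sparseLen s e ≤ shiftOn c ⊎ (at sparseRev (shiftOn c) ≡ just c × ¬ at P e ≡ just c)
    shiftOn-cases c with eqM? (just c) (at P e) in eq
    ... | true  = inj₁ longShift≥sparseLen
    ... | false with shiftc-cases c
    ...   | inj₁ long = inj₁ long
    ...   | inj₂ read = inj₂ (read , eqM?-false c (at P e) eq)

    shiftOn-pos : ∀ c → 0 < shiftOn c
    shiftOn-pos c with shiftOn c | shiftOn-cases c
    ... | suc _ | _                     = z<s
    ... | zero  | inj₁ ()
    ... | zero  | inj₂ (read , c≢endc) = contradiction (trans (sym sparseRev-head) read) c≢endc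

    shiftOn-injectiveBelow : InjectiveBelow (sparseLen s e) shiftOn
    shiftOn-injectiveBelow c c′ same short with shiftOn-cases c | shiftOn-cases c′
    ... | inj₁ long       | _                = contradiction long (<⇒≱ short)
    ... | inj₂ _          | inj₁ long′       = contradiction (subst (sparseLen s e ≤_) (sym same) long′) (<⇒≱ short)
    ... | inj₂ (read , _) | inj₂ (read′ , _) = just-injective (trans (sym read) (trans (cong (at sparseRev) same) read′))

  module _ (e<n : e < length P) where

    private
      G : ℕ
      G = length P ∸ e

    runFrom≡shifts : ∀ T f i → map proj₂ (runFrom P s e T f i) ≡ shifts shiftOn G f (drop (i + e) T)
    runFrom≡shifts T zero    i = refl
    runFrom≡shifts T (suc f) i with (i + length P) ≤? length T
    ... | no doesNotFit = sym (shifts-stop shiftOn G f (drop (i + e) T) (doesNotFit ∘ fits-from-suffix))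
      where
      fits-from-suffix : G ≤ length (drop (i + e) T) → i + length P ≤ length T
      fits-from-suffix = window-fits⇐ i e (length P) (length T) e<n ∘ subst (G ≤_) (length-drop (i + e) T)
    ... | yes fits with drop (i + e) T in suffix≡
    ...   | []    = contradiction (subst (G ≤_) (cong length suffix≡) G≤suffix) (<⇒≱ (m<n⇒0<n∸m e<n))
      where
      G≤suffix : G ≤ length (drop (i + e) T)
      G≤suffix = subst (G ≤_) (sym (length-drop (i + e) T)) (window-fits⇒ i e (length P) (length T) fits)
    ...   | c ∷ U = begin
      sh ∷ map proj₂ (runFrom P s e T f (i + sh))
        ≡⟨ cong (λ x → x ∷ map proj₂ (runFrom P s e T f (i + x))) (step-shift T i c (drop≡∷⇒at (i + e) T suffix≡)) ⟩
      shiftOn c ∷ map proj₂ (runFrom P s e T f (i + shiftOn c))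
        ≡⟨ cong (shiftOn c ∷_) (runFrom≡shifts T f (i + shiftOn c)) ⟩
      shiftOn c ∷ shifts shiftOn G f (drop (i + shiftOn c + e) T)
        ≡⟨ cong (λ xs → shiftOn c ∷ shifts shiftOn G f xs) drop-shifted ⟩
      shiftOn c ∷ shifts shiftOn G f (drop (shiftOn c) (c ∷ U))
        ≡⟨ shifts-step shiftOn G f c U G≤suffix ⟨
      shifts shiftOn G (suc f) (c ∷ U) ∎
      where
      open ≡-Reasoning
      sh = proj₂ (step P s e T i)
      G≤suffix : G ≤ length (c ∷ U)
      G≤suffix = subst (G ≤_) (trans (sym (length-drop (i + e) T)) (cong length suffix≡))
                       (window-fits⇒ i e (length P) (length T) fits)
      drop-shifted : drop (i + shiftOn c + e) T ≡ drop (shiftOn c) (c ∷ U)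
      drop-shifted = begin
        drop (i + shiftOn c + e) T          ≡⟨ cong (λ j → drop j T) (xy∙z≈xz∙y i (shiftOn c) e) ⟩
        drop (i + e + shiftOn c) T          ≡⟨ drop-drop (i + e) (shiftOn c) T ⟨
        drop (shiftOn c) (drop (i + e) T)   ≡⟨ cong (drop (shiftOn c)) suffix≡ ⟩
        drop (shiftOn c) (c ∷ U)            ∎

  kthShift≡kth : ∀ evs k → kthShift evs k ≡ kth (map proj₂ evs) k
  kthShift≡kth []        k       = refl
  kthShift≡kth (_ ∷ _)   zero    = refl
  kthShift≡kth (_ ∷ evs) (suc k) = kthShift≡kth evs k

  totalKthShift-mean : s ≤ e → e < length P → ∀ m k →
    (∑[ c < Δ ] shiftOn c) * countHasEvent P s e m k ≡ Δ * totalKthShift P s e m k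
  totalKthShift-mean s≤e e<n m k = begin
    ∑F * countHasEvent P s e m k                                ≡⟨ cong (∑F *_) count≡ ⟩
    ∑F * ∑Strings m (λ T → hasKth k (shiftsFrom T))              ≡⟨ ∑Strings-*ˡ m ∑F _ ⟨
    ∑Strings m (λ T → ∑F * hasKth k (shiftsFrom T))              ≡⟨ mean ⟨
    ∑Strings m (λ T → Δ * kth (shiftsFrom T) k)                  ≡⟨ ∑Strings-*ˡ m Δ _ ⟩
    Δ * ∑Strings m (λ T → kth (shiftsFrom T) k)                  ≡⟨ cong (Δ *_) total≡ ⟨
    Δ * totalKthShift P s e m k                                  ∎
    where
    open ≡-Reasoning
    ∑F = ∑[ c < Δ ] shiftOn c
    G = length P ∸ e
    shiftsFrom : List (Fin Δ) → List ℕ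
    shiftsFrom T = shifts shiftOn G (suc m) (drop e T)
    run≡ : ∀ T → length T ≡ m → map proj₂ (run P s e T) ≡ shiftsFrom T
    run≡ T refl = runFrom≡shifts e<n T (suc (length T)) 0
    count≡ : countHasEvent P s e m k ≡ ∑Strings m (λ T → hasKth k (shiftsFrom T))
    count≡ = trans (sum-allStrings m _) (∑Strings-cong m λ T len →
      cong (λ l → if k <ᵇ l then 1 else 0) (trans (sym (length-map proj₂ (run P s e T))) (cong length (run≡ T len))))
    total≡ : totalKthShift P s e m k ≡ ∑Strings m (λ T → kth (shiftsFrom T) k)
    total≡ = trans (sum-allStrings m _) (∑Strings-cong m λ T len →
      trans (kthShift≡kth (run P s e T) k) (cong (λ l → kth l k) (run≡ T len)))
    mean : ∑Strings m (λ T → Δ * kth (shiftsFrom T) k) ≡ ∑Strings m (λ T → ∑F * hasKth k (shiftsFrom T))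
    mean = ∑Strings-drop-cong (shifts-mean shiftOn G (shiftOn-pos s≤e e<n) k (suc m)) e m

bound-from-mean : ∀ Δ .{{_ : NonZero Δ}} M S c t → Δ * M ≤ 2 * S → S * c ≡ Δ * t → 1 * M * c ≤ 2 * t
bound-from-mean Δ M S c t ΔM≤2S Sc≡Δt = *-cancelˡ-≤ Δ (begin
  Δ * (1 * M * c)   ≡⟨ cong (Δ *_) (cong (_* c) (*-identityˡ M)) ⟩
  Δ * (M * c)       ≡⟨ *-assoc Δ M c ⟨
  Δ * M * c         ≤⟨ *-monoˡ-≤ c ΔM≤2S ⟩
  2 * S * c         ≡⟨ *-assoc 2 S c ⟩
  2 * (S * c)       ≡⟨ cong (2 *_) Sc≡Δt ⟩
  2 * (Δ * t)       ≡⟨ x*[y*z]≡y*[x*z] 2 Δ t ⟩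
  Δ * (2 * t)       ∎)
  where
  open ≤-Reasoning
  x*[y*z]≡y*[x*z] : ∀ x y z → x * (y * z) ≡ y * (x * z)
  x*[y*z]≡y*[x*z] = solve-∀

lemma5 : Σ ℕ λ a → Σ ℕ λ b → 0 < a × 0 < b ×
    (∀ (Δ : ℕ) (P : List (Fin Δ)) → 0 < length P →
     ∀ (s e : ℕ) → IsSparse P s e →
     ∀ (m k : ℕ) →
       a * (sparseLen s e ⊓ Δ) * countHasEvent P s e m k
         ≤ b * totalKthShift P s e m k)
lemma5 = 1 , 2 , z<s , z<s , bound
  where
  bound : ∀ (Δ : ℕ) (P : List (Fin Δ)) → 0 < length P → ∀ (s e : ℕ) → IsSparse P s e → ∀ (m k : ℕ) →
          1 * (sparseLen s e ⊓ Δ) * countHasEvent P s e m k ≤ 2 * totalKthShift P s e m k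
  bound Δ P@(p ∷ _) _ s e ((s≤e , e<n , _) , _) m k =
    bound-from-mean Δ {{nonZeroIndex p}} (sparseLen s e ⊓ Δ) (∑[ c < Δ ] shiftOn P s e c) _ _
      (Δ*[L⊓Δ]≤2*∑ (shiftOn P s e) (shiftOn-pos P s e s≤e e<n) (shiftOn-injectiveBelow P s e s≤e e<n))
      (totalKthShift-mean P s e s≤e e<n m k)
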